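{- Let $\mathcal{M},s$ and $\mathcal{M}',s'$ be pointed dependence epistemic models (over the same $\mathbb{P},\mathbb{V}$). Let $\mathcal{D}$ be either $\mathcal{D}_g$ (with $\mathcal{P}=\mathcal{P}_g$) or $\mathcal{D}_l$ (with $\mathcal{P}=\mathcal{P}_l$). Then for all finite $X,Y\subseteq\mathbb{V}$ ($\mathcal{M},s\vDash\mathcal{D}(X,Y)$ iff $\mathcal{M}',s'\vDash\mathcal{D}(X,Y)$) holds if and only if both: (Zig) every $W\in\mathcal{P}(s)$ is generative from $\mathcal{P}(s')$; and (Zag) every $W\in\mathcal{P}(s')$ is generative from $\mathcal{P}(s)$.
   Context: Fix a countable set $\mathbb{P}$ of propositions and a countable set $\mathbb{V}$ of variables. A dependence epistemic model is $\mathcal{M}=\langle S,T,V,U,\sim_i,\approx\rangle$ where $S$ is a set of worlds, $T:S\times\mathbb{P}\to\{0,1\}$, $V\supseteq\mathbb{V}$ is a countable set of variables, $U:S\times V\to\mathbb{N}$, and $\sim_i,\approx$ are equivalence relations on $S$. For $s,t\in S$ and $X\subseteq V$, write $X_s=X_t$ iff $U(s,x)=U(t,x)$ for all $x\in X$, and $X_s\neq X_t$ otherwise. Semantics (for finite $X,Y\subseteq\mathbb{V}$): $\mathcal{M},s\vDash\mathcal{D}_g(X,Y)$ iff there exist $u,v\in S$ with $u\approx v\approx s$, $(V\setminus(X\cup Y))_u=(V\setminus(X\cup Y))_v$, $X_u\neq X_v$ and $Y_u\neq Y_v$; $\mathcal{M},s\vDash\mathcal{D}_l(X,Y)$ iff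 there exists $t\in S$ with $t\approx s$, $(V\setminus(X\cup Y))_t=(V\setminus(X\cup Y))_s$, $X_t\neq X_s$ and $Y_t\neq Y_s$. For $u,v\in S$, $\Delta(u,v)=\{x\in\mathbb{V}\mid U(u,x)\neq U(v,x)\}$ if $(V\setminus\mathbb{V})_u=(V\setminus\mathbb{V})_v$, and $\Delta(u,v)=\emptyset$ otherwise. $W$ is an evidence of $\langle X,Y\rangle$ iff $W\cap X\neq\emptyset$, $W\cap Y\neq\emptyset$, $W\subseteq X\cup Y$. $\mathcal{P}_g(s)=\{\Delta(u,v)\mid u,v\in S,\ u\approx v\approx s,\ \Delta(u,v)\text{ nonempty finite}\}$ and $\mathcal{P}_l(s)=\{\Delta(t,s)\mid t\in S,\ t\approx s,\ \Delta(t,s)\text{ nonempty finite}\}$. A nonempty finite $W\subseteq\mathbb{V}$ is generative from $\mathcal{P}(s)$ iff for all finite $X,Y\subseteq\mathbb{V}$ such that $W$ is an evidence of $\langle X,Y\rangle$, there is $W'\in\mathcal{P}(s)$ that is also an evidence of $\langle X,Y\rangle$. -}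

module Defs where

open import Data.Nat using (ℕ)
open import Data.Bool using (Bool)
open import Data.List using (List; _++_)
open import Data.List.Membership.Propositional using (_∈_)
open import Data.Product using (Σ; ∃; ∃-syntax; _×_; _,_)
open import Data.Sum using (_⊎_; inj₁; inj₂)
open import Relation.Nullary using (¬_)
open import Relation.Binary using (Rel; IsEquivalence)
open import Relation.Binary.PropositionalEquality using (_≡_; _≢_)
open import Function.Bundles using (_↣_; _⇔_)

record Signature : Set₁ where
  field
    Prop   : Set
    Var    : Set
    Agent  : Set
    Prop-countable : Prop ↣ ℕ
    Var-countable  : Var ↣ ℕ

-- A dependence epistemic model ⟨S,T,V,U,∼_i,≈⟩.
-- The countable variable set V ⊇ 𝕍 is represented as 𝕍 ⊎ Extra,
-- where Extra = V ∖ 𝕍 (countable).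
record Model (Σ₀ : Signature) : Set₁ where
  open Signature Σ₀
  field
    S        : Set
    T        : S → Prop → Bool
    Extra    : Set
    Extra-countable : Extra ↣ ℕ
    U        : S → (Var ⊎ Extra) → ℕ
    _∼[_]_   : S → Agent → S → Set
    ∼-equiv  : (i : Agent) → IsEquivalence (λ s t → s ∼[ i ] t)
    _≈_      : Rel S _
    ≈-equiv  : IsEquivalence _≈_

module _ {Σ₀ : Signature} (M : Model Σ₀) where
  open Signature Σ₀
  open Model M

  VarM : Set
  VarM = Var ⊎ Extra

  InUnion : List Var → List Var → VarM → Set
  InUnion X Y z = ∃[ x ] ((x ∈ X ⊎ x ∈ Y) × z ≡ inj₁ x)

  AgreeOn : (VarM → Set) → S → S → Set
  AgreeOn Z s t = ∀ z → Z z → U s z ≡ U t z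

  AgreeOff : List Var → List Var → S → S → Set
  AgreeOff X Y = AgreeOn (λ z → ¬ InUnion X Y z)

  AgreeOnList : List Var → S → S → Set
  AgreeOnList X = AgreeOn (λ z → ∃[ x ] (x ∈ X × z ≡ inj₁ x))

  SatDg : S → List Var → List Var → Set
  SatDg s X Y = ∃[ u ] ∃[ v ] (u ≈ v × v ≈ s × AgreeOff X Y u v
                 × ¬ AgreeOnList X u v × ¬ AgreeOnList Y u v)

  SatDl : S → List Var → List Var → Set
  SatDl s X Y = ∃[ t ] (t ≈ s × AgreeOff X Y t s
                 × ¬ AgreeOnList X t s × ¬ AgreeOnList Y t s)

  -- x ∈ Δ(u,v): (V∖𝕍)_u = (V∖𝕍)_v and U(u,x) ≠ U(v,x)
  -- (if (V∖𝕍)_u ≠ (V∖𝕍)_v, then Δ(u,v) = ∅, matching this predicate)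
  InΔ : S → S → Var → Set
  InΔ u v x = (∀ (e : Extra) → U u (inj₂ e) ≡ U v (inj₂ e))
              × U u (inj₁ x) ≢ U v (inj₁ x)

  IsΔ : S → S → List Var → Set
  IsΔ u v W = ∀ x → (x ∈ W ⇔ InΔ u v x)

  NonEmpty : List Var → Set
  NonEmpty W = ∃[ x ] (x ∈ W)

  -- W ∈ 𝒫_g(s), W ∈ 𝒫_l(s).  Elements of 𝒫 are nonempty finite subsets
  -- of 𝕍, represented by lists (up to extensional equality of membership).
  InPg : S → List Var → Set
  InPg s W = ∃[ u ] ∃[ v ] (u ≈ v × v ≈ s × IsΔ u v W × NonEmpty W)

  InPl : S → List Var → Set
  InPl s W = ∃[ t ] (t ≈ s × IsΔ t s W × NonEmpty W)

module _ {Σ₀ : Signature} where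
  open Signature Σ₀

  Evidence : List Var → List Var → List Var → Set
  Evidence W X Y = (∃[ w ] (w ∈ W × w ∈ X)) × (∃[ w ] (w ∈ W × w ∈ Y))
                   × (∀ w → w ∈ W → w ∈ X ⊎ w ∈ Y)

  Generative : (List Var → Set) → List Var → Set
  Generative P W = (∃[ x ] (x ∈ W)) ×
    (∀ (X Y : List Var) → Evidence W X Y → ∃[ W' ] (P W' × Evidence W' X Y))

data Mode : Set where
  global local : Mode

module _ {Σ₀ : Signature} where
  open Signature Σ₀

  Sat : Mode → (M : Model Σ₀) → Model.S M → List Var → List Var → Set
  Sat global M = SatDg M
  Sat local  M = SatDl M

  InP : Mode → (M : Model Σ₀) → Model.S M → List Var → Set
  InP global M = InPg M
  InP local  M = InPl M

-- Both semantic clauses ask for a pair of worlds, (u, v) resp. (t, s), that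
-- differs somewhere on X, somewhere on Y and nowhere outside X ∪ Y (nor on
-- V ∖ 𝕍). Such a pair is exactly one whose Δ is a nonempty evidence of
-- ⟨X, Y⟩: Δ is then the set of variables of X ∪ Y on which the pair differs,
-- a finite set computable by filtering X ++ Y. Hence 𝒟(X, Y) holds at s iff
-- 𝒫(s) contains an evidence of ⟨X, Y⟩, and the zig-zag conditions say
-- precisely that 𝒫(s) and 𝒫(s') have evidences for the same pairs.
module Submission where

open import Defs
open import Data.List using (List; filter; _++_)
open import Data.List.Membership.Propositional using (_∈_; find; lose)
open import Data.List.Membership.Propositional.Properties
  using (∈-filter⁺; ∈-filter⁻; ∈-++⁺ˡ; ∈-++⁺ʳ; ∈-++⁻)
open import Data.List.Relation.Unary.Any using (any?)
open import Data.Nat.Properties using (_≟_; eq?)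
open import Data.Product using (_×_; _,_; ∃-syntax; proj₁; proj₂)
open import Data.Sum using (_⊎_; inj₁; inj₂; [_,_])
open import Data.Empty using (⊥-elim)
open import Function.Bundles using (_⇔_; mk⇔; Equivalence)
open import Function.Construct.Composition using (_⇔-∘_)
open import Function using (_∘′_)
open import Function.Related.TypeIsomorphisms using (Related-cong)
open import Relation.Binary.PropositionalEquality using (_≡_; _≢_; refl)
open import Relation.Nullary using (¬_; Dec; yes; no; ¬?)
open import Relation.Nullary.Decidable using (decidable-stable)
import Data.List.Membership.DecPropositional as DecMembership

open Equivalence using (to; from)

pointwise-⇔-cong : ∀ {a b ℓ} {A : Set a} {B : Set b} {P P' Q Q' : A → B → Set ℓ} →
  (∀ x y → P x y ⇔ P' x y) → (∀ x y → Q x y ⇔ Q' x y) →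
  (∀ x y → P x y ⇔ Q x y) ⇔ (∀ x y → P' x y ⇔ Q' x y)
pointwise-⇔-cong P⇔P' Q⇔Q' = mk⇔
  (λ P⇔Q x y → to (Related-cong (P⇔P' x y) (Q⇔Q' x y)) (P⇔Q x y))
  (λ P'⇔Q' x y → from (Related-cong (P⇔P' x y) (Q⇔Q' x y)) (P'⇔Q' x y))

module _ {Σ₀ : Signature} where
  open Signature Σ₀

  EvidencedIn : (List Var → Set) → List Var → List Var → Set
  EvidencedIn P X Y = ∃[ W ] (P W × Evidence {Σ₀} W X Y)

  sameEvidence⇔mutuallyGenerative : {P P' : List Var → Set} →
    (∀ W → P W → ∃[ x ] (x ∈ W)) → (∀ W → P' W → ∃[ x ] (x ∈ W)) →
    (∀ X Y → EvidencedIn P X Y ⇔ EvidencedIn P' X Y)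
      ⇔ ((∀ W → P W → Generative {Σ₀} P' W) × (∀ W → P' W → Generative {Σ₀} P W))
  sameEvidence⇔mutuallyGenerative nonEmpty nonEmpty' = mk⇔
    (λ same → (λ W p → nonEmpty W p , λ X Y ev → to (same X Y) (W , p , ev))
            , (λ W p → nonEmpty' W p , λ X Y ev → from (same X Y) (W , p , ev)))
    (λ (zig , zag) X Y → mk⇔
      (λ (W , p , ev) → let (_ , generates) = zig W p in generates X Y ev)
      (λ (W , p , ev) → let (_ , generates) = zag W p in generates X Y ev))

module _ {Σ₀ : Signature} (M : Model Σ₀) where
  open Signature Σ₀
  open Model M

  DependenceWitness : List Var → List Var → S → S → Set
  DependenceWitness X Y u v =
    AgreeOff M X Y u v × ¬ AgreeOnList M X u v × ¬ AgreeOnList M Y u v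

  DiffersAt : S → S → Var → Set
  DiffersAt u v x = U u (inj₁ x) ≢ U v (inj₁ x)

  differsAt? : ∀ u v x → Dec (DiffersAt u v x)
  differsAt? u v x = ¬? (U u (inj₁ x) ≟ U v (inj₁ x))

  open DecMembership (eq? Var-countable) using (_∈?_)

  ¬agreeOnList⇒differsAt : ∀ {u v} X → ¬ AgreeOnList M X u v →
    ∃[ x ] (x ∈ X × DiffersAt u v x)
  ¬agreeOnList⇒differsAt {u} {v} X disagree with any? (differsAt? u v) X
  ... | yes someDiffer = find someDiffer
  ... | no noneDiffer = ⊥-elim (disagree λ { _ (x , x∈X , refl) →
          decidable-stable (U u (inj₁ x) ≟ U v (inj₁ x)) (noneDiffer ∘′ lose x∈X) })

  agreeOff⇒isΔ : ∀ {X Y u v} → AgreeOff M X Y u v →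
    IsΔ M u v (filter (differsAt? u v) (X ++ Y))
  agreeOff⇒isΔ {X} {Y} {u} {v} agreeOff x =
    mk⇔ (λ x∈W → agreeExtra , proj₂ (∈-filter⁻ (differsAt? u v) {xs = X ++ Y} x∈W))
        (λ (_ , differs) → ∈-filter⁺ (differsAt? u v) (differs⇒∈X++Y differs) differs)
    where
    agreeExtra : ∀ e → U u (inj₂ e) ≡ U v (inj₂ e)
    agreeExtra e = agreeOff (inj₂ e) λ ()
    differs⇒∈X++Y : DiffersAt u v x → x ∈ X ++ Y
    differs⇒∈X++Y differs with x ∈? X ++ Y
    ... | yes x∈X++Y = x∈X++Y
    ... | no x∉X++Y = ⊥-elim (differs (agreeOff (inj₁ x) λ { (_ , x∈X⊎Y , refl) →
            x∉X++Y ([ ∈-++⁺ˡ , ∈-++⁺ʳ X ] x∈X⊎Y) }))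

  ΔIsEvidence : List Var → List Var → S → S → Set
  ΔIsEvidence X Y u v = ∃[ W ] (IsΔ M u v W × NonEmpty M W × Evidence {Σ₀} W X Y)

  dependenceWitness⇔ΔIsEvidence : ∀ {X Y u v} →
    DependenceWitness X Y u v ⇔ ΔIsEvidence X Y u v
  dependenceWitness⇔ΔIsEvidence {X} {Y} {u} {v} = mk⇔ witness⇒evidence evidence⇒witness
    where
    witness⇒evidence : DependenceWitness X Y u v → ΔIsEvidence X Y u v
    witness⇒evidence (agreeOff , disagreeX , disagreeY)
      with ¬agreeOnList⇒differsAt X disagreeX | ¬agreeOnList⇒differsAt Y disagreeY
    ... | x , x∈X , x-differs | y , y∈Y , y-differs =
      W , agreeOff⇒isΔ agreeOff , (x , x∈W) , (x , x∈W , x∈X) , (y , y∈W , y∈Y) , W⊆X∪Y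
      where
      W = filter (differsAt? u v) (X ++ Y)
      x∈W = ∈-filter⁺ (differsAt? u v) (∈-++⁺ˡ x∈X) x-differs
      y∈W = ∈-filter⁺ (differsAt? u v) (∈-++⁺ʳ X y∈Y) y-differs
      W⊆X∪Y : ∀ w → w ∈ W → w ∈ X ⊎ w ∈ Y
      W⊆X∪Y w w∈W = ∈-++⁻ X (proj₁ (∈-filter⁻ (differsAt? u v) {xs = X ++ Y} w∈W))

    evidence⇒witness : ΔIsEvidence X Y u v → DependenceWitness X Y u v
    evidence⇒witness (W , isΔ , (w , w∈W) , (a , a∈W , a∈X) , (b , b∈W , b∈Y) , W⊆X∪Y) =
      agreeOff , disagreeOn a∈W a∈X , disagreeOn b∈W b∈Y
      where
      agreeExtra : ∀ e → U u (inj₂ e) ≡ U v (inj₂ e)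
      agreeExtra = proj₁ (to (isΔ w) w∈W)
      agreeOff : AgreeOff M X Y u v
      agreeOff (inj₂ e) _ = agreeExtra e
      agreeOff (inj₁ x) x∉X∪Y with U u (inj₁ x) ≟ U v (inj₁ x)
      ... | yes agree = agree
      ... | no differs = ⊥-elim (x∉X∪Y (x , W⊆X∪Y x (from (isΔ x) (agreeExtra , differs)) , refl))
      disagreeOn : ∀ {z Z} → z ∈ W → z ∈ Z → ¬ AgreeOnList M Z u v
      disagreeOn {z} z∈W z∈Z agree = proj₂ (to (isΔ z) z∈W) (agree (inj₁ z) (z , z∈Z , refl))

module _ {Σ₀ : Signature} where
  open Signature Σ₀

  sat⇔evidencedIn-InP : ∀ m (M : Model Σ₀) s X Y →
    Sat m M s X Y ⇔ EvidencedIn {Σ₀} (InP m M s) X Y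
  sat⇔evidencedIn-InP global M s X Y = mk⇔
    (λ (u , v , u≈v , v≈s , witness) →
      let (W , isΔ , nonEmpty , evidence) = to (dependenceWitness⇔ΔIsEvidence M) witness
      in W , (u , v , u≈v , v≈s , isΔ , nonEmpty) , evidence)
    (λ (W , (u , v , u≈v , v≈s , isΔ , nonEmpty) , evidence) →
      u , v , u≈v , v≈s , from (dependenceWitness⇔ΔIsEvidence M) (W , isΔ , nonEmpty , evidence))
  sat⇔evidencedIn-InP local M s X Y = mk⇔
    (λ (t , t≈s , witness) →
      let (W , isΔ , nonEmpty , evidence) = to (dependenceWitness⇔ΔIsEvidence M) witness
      in W , (t , t≈s , isΔ , nonEmpty) , evidence)
    (λ (W , (t , t≈s , isΔ , nonEmpty) , evidence) →
      t , t≈s , from (dependenceWitness⇔ΔIsEvidence M) (W , isΔ , nonEmpty , evidence))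

  InP⇒nonEmpty : ∀ m (M : Model Σ₀) s W → InP m M s W → ∃[ x ] (x ∈ W)
  InP⇒nonEmpty global M s W (_ , _ , _ , _ , _ , nonEmpty) = nonEmpty
  InP⇒nonEmpty local  M s W (_ , _ , _ , nonEmpty) = nonEmpty

mainTheorem3 : (Σ₀ : Signature) (m : Mode) (M M' : Model Σ₀)
    (s : Model.S M) (s' : Model.S M') →
    ((∀ (X Y : List (Signature.Var Σ₀)) → (Sat m M s X Y ⇔ Sat m M' s' X Y))
      ⇔ ((∀ W → InP m M s W → Generative {Σ₀} (InP m M' s') W)
         × (∀ W → InP m M' s' W → Generative {Σ₀} (InP m M s) W)))
mainTheorem3 Σ₀ m M M' s s' =
  sameEvidence⇔mutuallyGenerative {Σ₀} (InP⇒nonEmpty m M s) (InP⇒nonEmpty m M' s')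
    ⇔-∘ pointwise-⇔-cong (sat⇔evidencedIn-InP m M s) (sat⇔evidencedIn-InP m M' s')
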